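{- Let $G$ and $H$ be finite simple graphs, let $\mathscr{C}=\{C_1,\dots,C_q\}$ be a clique cover of $G$ (so $|\mathscr{C}|=q$), and let $U\subseteq V(H)$. Then $$I(G^{\mathscr{C}}\star H^U;x)=I^q(H;x)\,I\!\left(G;\frac{x\,I(H-U;x)}{I(H;x)}\right).$$
   Context: For a finite simple graph $G$, $i_k(G)$ is the number of independent sets of size $k$ in $G$ ($i_0(G)=1$), $\alpha(G)$ is the size of a maximum independent set, and the independence polynomial is $I(G;x)=\sum_{k=0}^{\alpha(G)} i_k(G)x^k$. For $U\subseteq V(H)$, $H-U$ is the subgraph induced on $V(H)\setminus U$. A clique cover of $G$ is a spanning subgraph of $G$ each of whose connected components is a clique; we view it as the collection $\mathscr{C}=\{C_1,\dots,C_q\}$ of these cliques, which partition $V(G)$. The clique cover product $G^{\mathscr{C}}\star H^U$ is the graph obtained from $G$ by, for each clique $C_i\in\mathscr{C}$, adding a new disjoint copy of $H$ and joining every vertex of $C_i$ to every vertex of the copy of $U$ in that copy of $H$. $I^q(H;x)$ denotes $(I(H;x))^q$. -}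

module Defs where

open import Data.Nat as ℕ using (ℕ; zero; suc)
open import Data.Bool using (Bool; true; false; _∧_; _∨_; not; if_then_else_)
open import Data.Fin using (Fin; splitAt; remQuot)
open import Data.Fin.Properties using (_≟_)
open import Data.Fin.Subset using (Subset; ∣_∣)
open import Data.Vec using (Vec; []; _∷_; lookup)
open import Data.List using (tabulate; List; []; _∷_; map; _++_; filter; length)
open import Data.Product using (_×_; _,_; Σ)
open import Data.Sum using (_⊎_; inj₁; inj₂)
open import Relation.Nullary.Decidable using (⌊_⌋)
open import Relation.Binary.PropositionalEquality using (_≡_; _≢_)
open import Data.Rational using (ℚ; 0ℚ; 1ℚ; _+_; _*_; _/_)
open import Data.Integer using (+_)

Adj : ℕ → Set
Adj n = Fin n → Fin n → Bool

IsSimple : ∀ {n} → Adj n → Set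
IsSimple {n} adj = (∀ u v → adj u v ≡ adj v u) × (∀ v → adj v v ≡ false)

allL : ∀ {A : Set} → (A → Bool) → List A → Bool
allL p []       = true
allL p (x ∷ xs) = p x ∧ allL p xs

-- S is an independent set: no two (possibly equal) members are adjacent
-- (for loopless graphs this is the usual notion).
isIndep : ∀ {n} → Adj n → Subset n → Bool
isIndep {n} adj S =
  allL (λ u → allL (λ v → not (lookup S u ∧ lookup S v ∧ adj u v)) (tabulate {n = n} (λ i → i))) (tabulate {n = n} (λ i → i))

isSubsetOf : ∀ {n} → Subset n → Subset n → Bool
isSubsetOf {n} S W = allL (λ v → not (lookup S v) ∨ lookup W v) (tabulate {n = n} (λ i → i))

compl : ∀ {n} → Subset n → Subset n
compl []       = []
compl (b ∷ bs) = not b ∷ compl bs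

countL : ∀ {A : Set} → (A → Bool) → List A → ℕ
countL p []       = 0
countL p (x ∷ xs) = if p x then suc (countL p xs) else countL p xs

allSubsets : (n : ℕ) → List (Subset n)
allSubsets zero    = [] ∷ []
allSubsets (suc n) = map (true ∷_) (allSubsets n) ++ map (false ∷_) (allSubsets n)

-- i_k of the subgraph of G induced on W: the number of independent sets of size k
-- of G all of whose vertices lie in W (these are exactly the independent sets
-- of G[W]).
indCountOn : ∀ {n} → Adj n → Subset n → ℕ → ℕ
indCountOn {n} adj W k =
  countL (λ S → ⌊ ℕ._≟_ ∣ S ∣ k ⌋ ∧ isIndep adj S ∧ isSubsetOf S W) (allSubsets n)

full : ∀ {n} → Subset n
full {zero}  = []
full {suc n} = true ∷ full

indCount : ∀ {n} → Adj n → ℕ → ℕ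
indCount adj k = indCountOn adj full k

_^ℚ_ : ℚ → ℕ → ℚ
x ^ℚ zero  = 1ℚ
x ^ℚ suc k = x * (x ^ℚ k)

sumTo : ℕ → (ℕ → ℚ) → ℚ
sumTo zero    f = f 0
sumTo (suc N) f = sumTo N f + f (suc N)

-- Evaluation of the independence polynomial of G[W] at x:
-- Σ_{k=0}^{n} i_k(G[W]) x^k  (terms with k > α vanish, so summing up to n = |V| is the same
-- as summing up to α).
indPolyOn : ∀ {n} → Adj n → Subset n → ℚ → ℚ
indPolyOn {n} adj W x = sumTo n (λ k → ((+ indCountOn adj W k) / 1) * (x ^ℚ k))

indPoly : ∀ {n} → Adj n → ℚ → ℚ
indPoly adj x = indPolyOn adj full x

indPolyMinus : ∀ {m} → Adj m → Subset m → ℚ → ℚ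
indPolyMinus adjH U x = indPolyOn adjH (compl U) x

-- A clique cover of G with q cliques, given as the map c : V(G) → Fin q sending
-- each vertex to (the index of) its clique.
IsCliqueCover : ∀ {n} → Adj n → (q : ℕ) → (Fin n → Fin q) → Set
IsCliqueCover {n} adj q c =
  (∀ (i : Fin q) → Σ (Fin n) (λ v → c v ≡ i)) ×
  (∀ u v → u ≢ v → c u ≡ c v → adj u v ≡ true)

-- The clique cover product G^C ⋆ H^U on vertex set Fin (n + q * m):
-- a vertex is either a vertex of G, or a pair (i , a) = vertex a of the i-th copy of H.
prodVertex : ∀ n q m → Fin (n ℕ.+ q ℕ.* m) → Fin n ⊎ (Fin q × Fin m)
prodVertex n q m v with splitAt n v
... | inj₁ u = inj₁ u
... | inj₂ w = inj₂ (remQuot m w)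

prodAdj' : ∀ {n q m} → Adj n → (Fin n → Fin q) → Adj m → Subset m →
           Fin n ⊎ (Fin q × Fin m) → Fin n ⊎ (Fin q × Fin m) → Bool
prodAdj' adjG c adjH U (inj₁ u)       (inj₁ v)       = adjG u v
prodAdj' adjG c adjH U (inj₁ u)       (inj₂ (i , a)) = ⌊ c u ≟ i ⌋ ∧ lookup U a
prodAdj' adjG c adjH U (inj₂ (i , a)) (inj₁ u)       = ⌊ c u ≟ i ⌋ ∧ lookup U a
prodAdj' adjG c adjH U (inj₂ (i , a)) (inj₂ (j , b)) = ⌊ i ≟ j ⌋ ∧ adjH a b

cliqueCoverProduct : ∀ {n m} → Adj n → (q : ℕ) → (Fin n → Fin q) → Adj m → Subset m →
                     Adj (n ℕ.+ q ℕ.* m)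
cliqueCoverProduct {n} {m} adjG q c adjH U u v =
  prodAdj' adjG c adjH U (prodVertex n q m u) (prodVertex n q m v)

module Submission where

-- Idea.  I(G[W]; x) is the sum, over all vertex subsets S, of [S independent, S ⊆ W]·x^|S|.
-- A vertex subset of the product is a pair (S, T) with S ⊆ V(G) and T = (T_1, …, T_q),
-- T_i a subset of the i-th copy of H.  It is independent iff S is independent in G, each
-- T_i is independent in H, and T_i avoids U whenever S meets the clique C_i.  Hence the
-- sum over T factorises into ∏_i (I(H-U; x) if S meets C_i, I(H; x) otherwise).  An
-- independent S meets each clique at most once, so it meets exactly |S| cliques, and the
-- product equals I(H)^q · (I(H-U)/I(H))^|S|; summing over S gives the formula.

open import Defs
open import Algebra.Bundles using (CommutativeMonoid)
import Algebra.Properties.CommutativeSemigroup as CommSemigroupProperties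
open import Data.Bool using (Bool; true; false; _∧_; _∨_; not; if_then_else_)
open import Data.Bool.Properties using (∧-identityʳ; ∨-zeroʳ)
open import Data.Empty using (⊥-elim)
open import Data.Fin as F using (Fin; splitAt; remQuot; combine; _↑ˡ_; _↑ʳ_)
import Data.Fin.Properties as FP
open import Data.Fin.Subset using (Subset; ∣_∣)
open import Data.Fin.Subset.Properties using (∣p∣≤n)
open import Data.Integer as ℤ using () renaming (+_ to pos)
import Data.Integer.Properties as ℤP
open import Data.Integer.Tactic.RingSolver using (solve-∀)
open import Data.List as L using (List; []; _∷_; map)
import Data.List.Properties as LP
open import Data.Nat as ℕ using (ℕ; zero; suc; _≤_; _<_; z≤n)
open import Data.Nat.Coprimality using (1-coprimeTo) renaming (sym to coprime-sym)
import Data.Nat.Properties as ℕP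
open import Data.Product using (_×_; _,_; Σ; proj₂)
open import Data.Rational using (ℚ; 0ℚ; 1ℚ; _+_; _*_; _/_; mkℚ; toℚᵘ; NonZero; _÷_; 1/_)
open import Data.Rational.Properties
import Data.Rational.Unnormalised as ℚᵘ
import Data.Rational.Unnormalised.Properties as ℚᵘP
open import Data.Sum using (_⊎_; inj₁; inj₂)
open import Data.Vec as V using (Vec; []; _∷_; lookup)
import Data.Vec.Properties as VP
open import Relation.Binary.PropositionalEquality
open import Relation.Nullary.Decidable using (⌊_⌋; yes; no)

open CommSemigroupProperties (CommutativeMonoid.commutativeSemigroup *-1-commutativeMonoid)
  using () renaming (interchange to *-interchange; x∙yz≈y∙xz to *-leftComm)
open CommSemigroupProperties ℕP.+-commutativeSemigroup
  using () renaming (interchange to +ℕ-interchange)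
open CommSemigroupProperties (CommutativeMonoid.commutativeSemigroup +-0-commutativeMonoid)
  using () renaming (interchange to +-interchange)

∧-true₁ : ∀ {a b} → a ∧ b ≡ true → a ≡ true
∧-true₁ {true} _ = refl

∧-true₂ : ∀ {a b} → a ∧ b ≡ true → b ≡ true
∧-true₂ {true} e = e

true-∧ : ∀ {a b} → a ≡ true → b ≡ true → a ∧ b ≡ true
true-∧ refl refl = refl

not-true : ∀ {b} → not b ≡ true → b ≡ false
not-true {false} _ = refl

bool-ext : ∀ {a b} → (a ≡ true → b ≡ true) → (b ≡ true → a ≡ true) → a ≡ b
bool-ext {true}  {true}  _ _ = refl
bool-ext {true}  {false} f _ = sym (f refl)
bool-ext {false} {true}  _ g = g refl
bool-ext {false} {false} _ _ = refl

allF : ∀ q → (Fin q → Bool) → Bool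
allF zero    p = true
allF (suc q) p = p F.zero ∧ allF q (λ i → p (F.suc i))

anyF : ∀ q → (Fin q → Bool) → Bool
anyF zero    p = false
anyF (suc q) p = p F.zero ∨ anyF q (λ i → p (F.suc i))

allF-cong : ∀ q {p p′ : Fin q → Bool} → (∀ i → p i ≡ p′ i) → allF q p ≡ allF q p′
allF-cong zero    eq = refl
allF-cong (suc q) eq = cong₂ _∧_ (eq F.zero) (allF-cong q (λ i → eq (F.suc i)))

allF⇒ : ∀ q (p : Fin q → Bool) → allF q p ≡ true → ∀ i → p i ≡ true
allF⇒ (suc q) p e F.zero    = ∧-true₁ e
allF⇒ (suc q) p e (F.suc i) = allF⇒ q (λ j → p (F.suc j)) (∧-true₂ {p F.zero} e) i

⇒allF : ∀ q (p : Fin q → Bool) → (∀ i → p i ≡ true) → allF q p ≡ true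
⇒allF zero    p h = refl
⇒allF (suc q) p h = true-∧ (h F.zero) (⇒allF q (λ j → p (F.suc j)) (λ j → h (F.suc j)))

anyF⇒ : ∀ q (p : Fin q → Bool) → anyF q p ≡ true → Σ (Fin q) (λ i → p i ≡ true)
anyF⇒ (suc q) p e with p F.zero in e₀
... | true  = F.zero , e₀
... | false with anyF⇒ q (λ j → p (F.suc j)) e
...   | i , eᵢ = F.suc i , eᵢ

⇒anyF : ∀ q (p : Fin q → Bool) i → p i ≡ true → anyF q p ≡ true
⇒anyF (suc q) p F.zero    e rewrite e = refl
⇒anyF (suc q) p (F.suc i) e rewrite ⇒anyF q (λ j → p (F.suc j)) i e = ∨-zeroʳ (p F.zero)

allL-allFin : ∀ {A : Set} n (p : A → Bool) (f : Fin n → A) →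
              allL p (L.tabulate f) ≡ allF n (λ i → p (f i))
allL-allFin zero    p f = refl
allL-allFin (suc n) p f = cong (p (f F.zero) ∧_) (allL-allFin n p (λ i → f (F.suc i)))

≟-true : ∀ {q} {j k : Fin q} → j ≡ k → ⌊ j FP.≟ k ⌋ ≡ true
≟-true {j = j} refl with j FP.≟ j
... | yes _ = refl
... | no j≢j = ⊥-elim (j≢j refl)

≟-true⁻¹ : ∀ {q} {j k : Fin q} → ⌊ j FP.≟ k ⌋ ≡ true → j ≡ k
≟-true⁻¹ {j = j} {k} e with j FP.≟ k
... | yes j≡k = j≡k

Independent : ∀ {n} → Adj n → Subset n → Set
Independent adj S = ∀ u v → lookup S u ≡ true → lookup S v ≡ true → adj u v ≡ false

isIndep-allF : ∀ {n} (adj : Adj n) S →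
               isIndep adj S ≡ allF n (λ u → allF n (λ v → not (lookup S u ∧ lookup S v ∧ adj u v)))
isIndep-allF {n} adj S = trans (allL-allFin n _ (λ i → i)) (allF-cong n (λ u → allL-allFin n _ (λ i → i)))

isIndep⇒Independent : ∀ {n} (adj : Adj n) S → isIndep adj S ≡ true → Independent adj S
isIndep⇒Independent {n} adj S e u v Su Sv =
  excluded _ _ _ (allF⇒ n _ (allF⇒ n _ (trans (sym (isIndep-allF adj S)) e) u) v) Su Sv
  where
  excluded : ∀ a b c → not (a ∧ b ∧ c) ≡ true → a ≡ true → b ≡ true → c ≡ false
  excluded true true false _ refl refl = refl

Independent⇒isIndep : ∀ {n} (adj : Adj n) S → Independent adj S → isIndep adj S ≡ true
Independent⇒isIndep {n} adj S h =
  trans (isIndep-allF adj S) (⇒allF n _ (λ u → ⇒allF n _ (λ v → excluded _ _ _ (h u v))))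
  where
  excluded : ∀ a b c → (a ≡ true → b ≡ true → c ≡ false) → not (a ∧ b ∧ c) ≡ true
  excluded true  true  true  h with h refl refl
  ... | ()
  excluded true  true  false _ = refl
  excluded true  false c     _ = refl
  excluded false b     c     _ = refl

isSubsetOf-allF : ∀ {n} (S W : Subset n) → isSubsetOf S W ≡ allF n (λ v → not (lookup S v) ∨ lookup W v)
isSubsetOf-allF {n} S W = allL-allFin n _ (λ i → i)

isSubsetOf⇒⊆ : ∀ {n} (S W : Subset n) → isSubsetOf S W ≡ true → ∀ a → lookup S a ≡ true → lookup W a ≡ true
isSubsetOf⇒⊆ {n} S W e a Sa with allF⇒ n _ (trans (sym (isSubsetOf-allF S W)) e) a
... | member rewrite Sa = member

⊆⇒isSubsetOf : ∀ {n} (S W : Subset n) → (∀ a → lookup S a ≡ true → lookup W a ≡ true) → isSubsetOf S W ≡ true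
⊆⇒isSubsetOf {n} S W h = trans (isSubsetOf-allF S W) (⇒allF n _ pointwise)
  where
  pointwise : ∀ a → not (lookup S a) ∨ lookup W a ≡ true
  pointwise a with lookup S a in Sa
  ... | false = refl
  ... | true  = h a Sa

lookup-full : ∀ {n} (a : Fin n) → lookup (full {n}) a ≡ true
lookup-full F.zero    = refl
lookup-full (F.suc a) = lookup-full a

⊆-full : ∀ {n} (S : Subset n) → isSubsetOf S full ≡ true
⊆-full S = ⊆⇒isSubsetOf S full (λ a _ → lookup-full a)

lookup-compl : ∀ {n} (U : Subset n) a → lookup (compl U) a ≡ not (lookup U a)
lookup-compl (b ∷ U) F.zero    = refl
lookup-compl (b ∷ U) (F.suc a) = lookup-compl U a

ind : Bool → ℚ
ind b = if b then 1ℚ else 0ℚ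

ind-∧ : ∀ a b → ind (a ∧ b) ≡ ind a * ind b
ind-∧ true  b = sym (*-identityˡ (ind b))
ind-∧ false b = sym (*-zeroˡ (ind b))

^ℚ-+ : ∀ x a b → x ^ℚ (a ℕ.+ b) ≡ (x ^ℚ a) * (x ^ℚ b)
^ℚ-+ x zero    b = sym (*-identityˡ _)
^ℚ-+ x (suc a) b = trans (cong (x *_) (^ℚ-+ x a b)) (sym (*-assoc x _ _))

^ℚ-* : ∀ x y a → (x * y) ^ℚ a ≡ (x ^ℚ a) * (y ^ℚ a)
^ℚ-* x y zero    = sym (*-identityˡ 1ℚ)
^ℚ-* x y (suc a) = trans (cong ((x * y) *_) (^ℚ-* x y a)) (*-interchange x y _ _)

n/1≡mkℚ : ∀ n → pos n / 1 ≡ mkℚ (pos n) 0 (coprime-sym (1-coprimeTo n))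
n/1≡mkℚ n = normalize-coprime (coprime-sym (1-coprimeTo n))

suc/1 : ∀ n → pos (suc n) / 1 ≡ 1ℚ + pos n / 1
suc/1 n rewrite n/1≡mkℚ n | n/1≡mkℚ (suc n) =
  toℚᵘ-injective (ℚᵘP.≃-trans (ℚᵘ.*≡* cross-multiplied) (ℚᵘP.≃-sym (toℚᵘ-homo-+ 1ℚ n/1)))
  where
  n/1 : ℚ
  n/1 = mkℚ (pos n) 0 (coprime-sym (1-coprimeTo n))
  ring : ∀ a → (pos 1 ℤ.+ a) ℤ.* (pos 1 ℤ.* pos 1) ≡ (pos 1 ℤ.* pos 1 ℤ.+ a ℤ.* pos 1) ℤ.* pos 1
  ring = solve-∀
  cross-multiplied : pos (suc n) ℤ.* (pos 1 ℤ.* pos 1) ≡ (pos 1 ℤ.* pos 1 ℤ.+ pos n ℤ.* pos 1) ℤ.* pos 1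
  cross-multiplied = trans (cong (ℤ._* (pos 1 ℤ.* pos 1)) (ℤP.pos-+ 1 n)) (ring (pos n))

toN : Bool → ℕ
toN true  = 1
toN false = 0

sumN : ∀ n → (Fin n → ℕ) → ℕ
sumN zero    f = 0
sumN (suc n) f = f F.zero ℕ.+ sumN n (λ i → f (F.suc i))

sumN-cong : ∀ n {f g : Fin n → ℕ} → (∀ i → f i ≡ g i) → sumN n f ≡ sumN n g
sumN-cong zero    eq = refl
sumN-cong (suc n) eq = cong₂ ℕ._+_ (eq F.zero) (sumN-cong n (λ i → eq (F.suc i)))

sumN-zero : ∀ n → sumN n (λ _ → 0) ≡ 0
sumN-zero zero    = refl
sumN-zero (suc n) = sumN-zero n

sumN-+ : ∀ n (f g : Fin n → ℕ) → sumN n (λ i → f i ℕ.+ g i) ≡ sumN n f ℕ.+ sumN n g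
sumN-+ zero    f g = refl
sumN-+ (suc n) f g =
  trans (cong (f F.zero ℕ.+ g F.zero ℕ.+_) (sumN-+ n (λ i → f (F.suc i)) (λ i → g (F.suc i))))
        (+ℕ-interchange (f F.zero) (g F.zero) _ _)

sumN-swap : ∀ n q (f : Fin n → Fin q → ℕ) →
            sumN n (λ u → sumN q (λ i → f u i)) ≡ sumN q (λ i → sumN n (λ u → f u i))
sumN-swap zero    q f = sym (sumN-zero q)
sumN-swap (suc n) q f =
  trans (cong (sumN q (f F.zero) ℕ.+_) (sumN-swap n q (λ u → f (F.suc u))))
        (sym (sumN-+ q (f F.zero) (λ i → sumN n (λ u → f (F.suc u) i))))

sumN-atMostOne : ∀ n (p : Fin n → Bool) → (∀ u v → p u ≡ true → p v ≡ true → u ≡ v) →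
                 sumN n (λ u → toN (p u)) ≡ toN (anyF n p)
sumN-atMostOne zero    p unique = refl
sumN-atMostOne (suc n) p unique with p F.zero in p₀
... | true  = cong suc (trans (sumN-cong n rest-zero) (sumN-zero n))
  where
  rest-zero : ∀ i → toN (p (F.suc i)) ≡ 0
  rest-zero i with p (F.suc i) in pᵢ
  ... | false = refl
  ... | true with unique _ _ p₀ pᵢ
  ...   | ()
... | false = sumN-atMostOne n (λ u → p (F.suc u)) (λ u v pu pv → FP.suc-injective (unique _ _ pu pv))

sumN-δ : ∀ q (j : Fin q) → sumN q (λ i → toN ⌊ j FP.≟ i ⌋) ≡ 1
sumN-δ q j = trans (sumN-atMostOne q _ (λ u v ju jv → trans (sym (≟-true⁻¹ ju)) (≟-true⁻¹ jv)))
                   (cong toN (⇒anyF q _ j (≟-true refl)))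

prodF : ∀ q → (Fin q → ℚ) → ℚ
prodF zero    g = 1ℚ
prodF (suc q) g = g F.zero * prodF q (λ i → g (F.suc i))

prodF-cong : ∀ q {g h : Fin q → ℚ} → (∀ i → g i ≡ h i) → prodF q g ≡ prodF q h
prodF-cong zero    eq = refl
prodF-cong (suc q) eq = cong₂ _*_ (eq F.zero) (prodF-cong q (λ i → eq (F.suc i)))

prodF-* : ∀ q (f g : Fin q → ℚ) → prodF q (λ i → f i * g i) ≡ prodF q f * prodF q g
prodF-* zero    f g = sym (*-identityˡ 1ℚ)
prodF-* (suc q) f g =
  trans (cong (f F.zero * g F.zero *_) (prodF-* q (λ i → f (F.suc i)) (λ i → g (F.suc i))))
        (*-interchange (f F.zero) (g F.zero) _ _)

prodF-const : ∀ q K → prodF q (λ _ → K) ≡ K ^ℚ q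
prodF-const zero    K = refl
prodF-const (suc q) K = cong (K *_) (prodF-const q K)

^ℚ-sumN : ∀ x q (f : Fin q → ℕ) → x ^ℚ sumN q f ≡ prodF q (λ i → x ^ℚ f i)
^ℚ-sumN x zero    f = refl
^ℚ-sumN x (suc q) f = trans (^ℚ-+ x (f F.zero) _) (cong (x ^ℚ f F.zero *_) (^ℚ-sumN x q (λ i → f (F.suc i))))

ind-allF : ∀ q (p : Fin q → Bool) → ind (allF q p) ≡ prodF q (λ i → ind (p i))
ind-allF zero    p = refl
ind-allF (suc q) p = trans (ind-∧ (p F.zero) _) (cong (ind (p F.zero) *_) (ind-allF q (λ i → p (F.suc i))))

prodF-select : ∀ q K r (b : Fin q → Bool) →
               prodF q (λ i → if b i then r * K else K) ≡ (K ^ℚ q) * (r ^ℚ sumN q (λ i → toN (b i)))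
prodF-select q K r b = begin
    prodF q (λ i → if b i then r * K else K)
  ≡⟨ prodF-cong q (λ i → select (b i)) ⟩
    prodF q (λ i → K * (r ^ℚ toN (b i)))
  ≡⟨ prodF-* q (λ _ → K) (λ i → r ^ℚ toN (b i)) ⟩
    prodF q (λ _ → K) * prodF q (λ i → r ^ℚ toN (b i))
  ≡⟨ cong₂ _*_ (prodF-const q K) (sym (^ℚ-sumN r q (λ i → toN (b i)))) ⟩
    (K ^ℚ q) * (r ^ℚ sumN q (λ i → toN (b i)))
  ∎
  where
  open ≡-Reasoning
  select : ∀ c → (if c then r * K else K) ≡ K * (r ^ℚ toN c)
  select true  = trans (*-comm r K) (cong (K *_) (sym (*-identityʳ r)))
  select false = sym (*-identityʳ K)

sumL : List ℚ → ℚ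
sumL []       = 0ℚ
sumL (x ∷ xs) = x + sumL xs

sumL-++ : ∀ xs ys → sumL (xs L.++ ys) ≡ sumL xs + sumL ys
sumL-++ []       ys = sym (+-identityˡ _)
sumL-++ (x ∷ xs) ys = trans (cong (x +_) (sumL-++ xs ys)) (sym (+-assoc x _ _))

sumL-*ʳ : ∀ {A : Set} (f : A → ℚ) xs a → sumL (map f xs) * a ≡ sumL (map (λ y → f y * a) xs)
sumL-*ʳ f []       a = *-zeroˡ a
sumL-*ʳ f (x ∷ xs) a = trans (*-distribʳ-+ a (f x) _) (cong (f x * a +_) (sumL-*ʳ f xs a))

subsetSum : (N : ℕ) → (Subset N → ℚ) → ℚ
subsetSum N f = sumL (map f (allSubsets N))

subsetSum-cong : ∀ N {f g : Subset N → ℚ} → (∀ S → f S ≡ g S) → subsetSum N f ≡ subsetSum N g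
subsetSum-cong N eq = cong sumL (LP.map-cong eq (allSubsets N))

subsetSum-suc : ∀ N f → subsetSum (suc N) f ≡ subsetSum N (λ S → f (true ∷ S)) + subsetSum N (λ S → f (false ∷ S))
subsetSum-suc N f = begin
    sumL (map f (map (true ∷_) (allSubsets N) L.++ map (false ∷_) (allSubsets N)))
  ≡⟨ cong sumL (LP.map-++ f (map (true ∷_) (allSubsets N)) _) ⟩
    sumL (map f (map (true ∷_) (allSubsets N)) L.++ map f (map (false ∷_) (allSubsets N)))
  ≡⟨ sumL-++ (map f (map (true ∷_) (allSubsets N))) _ ⟩
    sumL (map f (map (true ∷_) (allSubsets N))) + sumL (map f (map (false ∷_) (allSubsets N)))
  ≡⟨ cong₂ _+_ (cong sumL (sym (LP.map-∘ (allSubsets N)))) (cong sumL (sym (LP.map-∘ (allSubsets N)))) ⟩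
    subsetSum N (λ S → f (true ∷ S)) + subsetSum N (λ S → f (false ∷ S))
  ∎
  where open ≡-Reasoning

subsetSum-*ʳ : ∀ N f a → subsetSum N (λ S → f S * a) ≡ subsetSum N f * a
subsetSum-*ʳ N f a = sym (sumL-*ʳ f (allSubsets N) a)

subsetSum-*ˡ : ∀ N f a → subsetSum N (λ S → a * f S) ≡ a * subsetSum N f
subsetSum-*ˡ N f a = trans (subsetSum-cong N (λ S → *-comm a (f S))) (trans (subsetSum-*ʳ N f a) (*-comm _ a))

subsetSum-++ : ∀ a b (f : Subset (a ℕ.+ b) → ℚ) →
               subsetSum (a ℕ.+ b) f ≡ subsetSum a (λ S → subsetSum b (λ T → f (S V.++ T)))
subsetSum-++ zero    b f = sym (+-identityʳ _)
subsetSum-++ (suc a) b f = begin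
    subsetSum (suc a ℕ.+ b) f
  ≡⟨ subsetSum-suc (a ℕ.+ b) f ⟩
    subsetSum (a ℕ.+ b) (λ S → f (true ∷ S)) + subsetSum (a ℕ.+ b) (λ S → f (false ∷ S))
  ≡⟨ cong₂ _+_ (subsetSum-++ a b _) (subsetSum-++ a b _) ⟩
    subsetSum a (λ S → subsetSum b (λ T → f (true ∷ S V.++ T))) + subsetSum a (λ S → subsetSum b (λ T → f (false ∷ S V.++ T)))
  ≡⟨ sym (subsetSum-suc a _) ⟩
    subsetSum (suc a) (λ S → subsetSum b (λ T → f (S V.++ T)))
  ∎
  where open ≡-Reasoning

sumTo-cong : ∀ N {f g : ℕ → ℚ} → (∀ k → f k ≡ g k) → sumTo N f ≡ sumTo N g
sumTo-cong zero    eq = eq 0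
sumTo-cong (suc N) eq = cong₂ _+_ (sumTo-cong N eq) (eq (suc N))

sumTo-+ : ∀ N (f g : ℕ → ℚ) → sumTo N (λ k → f k + g k) ≡ sumTo N f + sumTo N g
sumTo-+ zero    f g = refl
sumTo-+ (suc N) f g =
  trans (cong (_+ (f (suc N) + g (suc N))) (sumTo-+ N f g)) (+-interchange (sumTo N f) (sumTo N g) _ _)

sumTo-zero : ∀ N → sumTo N (λ _ → 0ℚ) ≡ 0ℚ
sumTo-zero zero    = refl
sumTo-zero (suc N) = trans (+-identityʳ _) (sumTo-zero N)

sumTo-sumL : ∀ {A : Set} N (h : ℕ → A → ℚ) xs →
             sumTo N (λ k → sumL (map (h k) xs)) ≡ sumL (map (λ a → sumTo N (λ k → h k a)) xs)
sumTo-sumL N h []       = sumTo-zero N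
sumTo-sumL N h (x ∷ xs) =
  trans (sumTo-+ N (λ k → h k x) (λ k → sumL (map (h k) xs))) (cong (sumTo N (λ k → h k x) +_) (sumTo-sumL N h xs))

sumTo-pick-beyond : ∀ N s (g : ℕ → ℚ) → N < s → sumTo N (λ k → if ⌊ s ℕ.≟ k ⌋ then g k else 0ℚ) ≡ 0ℚ
sumTo-pick-beyond zero    (suc s) g _ = refl
sumTo-pick-beyond (suc N) s g N<s with s ℕ.≟ suc N
... | yes refl = ⊥-elim (ℕP.<-irrefl refl N<s)
... | no _     = trans (+-identityʳ _) (sumTo-pick-beyond N s g (ℕP.<-trans (ℕP.n<1+n N) N<s))

sumTo-pick : ∀ N s (g : ℕ → ℚ) → s ≤ N → sumTo N (λ k → if ⌊ s ℕ.≟ k ⌋ then g k else 0ℚ) ≡ g s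
sumTo-pick zero    .zero g z≤n = refl
sumTo-pick (suc N) s g s≤N with s ℕ.≟ suc N
... | yes refl = trans (cong (_+ g (suc N)) (sumTo-pick-beyond N (suc N) g (ℕP.n<1+n N))) (+-identityˡ _)
... | no s≢N   = trans (+-identityʳ _) (sumTo-pick N s g (ℕ.s≤s⁻¹ (ℕP.≤∧≢⇒< s≤N s≢N)))

countL-as-sum : ∀ {A : Set} (p : A → Bool) xs → pos (countL p xs) / 1 ≡ sumL (map (λ a → ind (p a)) xs)
countL-as-sum p []       = refl
countL-as-sum p (x ∷ xs) with p x
... | true  = trans (suc/1 (countL p xs)) (cong (1ℚ +_) (countL-as-sum p xs))
... | false = trans (countL-as-sum p xs) (sym (+-identityˡ _))

indPolyOn-subsetSum : ∀ {N} (adj : Adj N) W x →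
  indPolyOn adj W x ≡ subsetSum N (λ S → ind (isIndep adj S ∧ isSubsetOf S W) * (x ^ℚ ∣ S ∣))
indPolyOn-subsetSum {N} adj W x = begin
    sumTo N (λ k → (pos (countL (sized k) (allSubsets N)) / 1) * (x ^ℚ k))
  ≡⟨ sumTo-cong N (λ k → cong (_* (x ^ℚ k)) (countL-as-sum (sized k) (allSubsets N))) ⟩
    sumTo N (λ k → sumL (map (λ S → ind (sized k S)) (allSubsets N)) * (x ^ℚ k))
  ≡⟨ sumTo-cong N (λ k → sumL-*ʳ (λ S → ind (sized k S)) (allSubsets N) (x ^ℚ k)) ⟩
    sumTo N (λ k → sumL (map (λ S → ind (sized k S) * (x ^ℚ k)) (allSubsets N)))
  ≡⟨ sumTo-sumL N (λ k S → ind (sized k S) * (x ^ℚ k)) (allSubsets N) ⟩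
    subsetSum N (λ S → sumTo N (λ k → ind (sized k S) * (x ^ℚ k)))
  ≡⟨ subsetSum-cong N onlySize ⟩
    subsetSum N (λ S → ind (good S) * (x ^ℚ ∣ S ∣))
  ∎
  where
  open ≡-Reasoning
  good : Subset N → Bool
  good S = isIndep adj S ∧ isSubsetOf S W
  sized : ℕ → Subset N → Bool
  sized k S = ⌊ ∣ S ∣ ℕ.≟ k ⌋ ∧ good S
  ind-∧-if : ∀ c b (y : ℚ) → ind (c ∧ b) * y ≡ (if c then ind b * y else 0ℚ)
  ind-∧-if true  b y = refl
  ind-∧-if false b y = *-zeroˡ y
  -- only the term k = |S| survives; it occurs since |S| ≤ N
  onlySize : ∀ S → sumTo N (λ k → ind (sized k S) * (x ^ℚ k)) ≡ ind (good S) * (x ^ℚ ∣ S ∣)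
  onlySize S = trans (sumTo-cong N (λ k → ind-∧-if ⌊ ∣ S ∣ ℕ.≟ k ⌋ (good S) (x ^ℚ k)))
                     (sumTo-pick N ∣ S ∣ (λ k → ind (good S) * (x ^ℚ k)) (∣p∣≤n S))

monomial : ∀ {N} → Adj N → ℚ → Subset N → ℚ
monomial adj x S = ind (isIndep adj S) * (x ^ℚ ∣ S ∣)

indPoly-subsetSum : ∀ {N} (adj : Adj N) x → indPoly adj x ≡ subsetSum N (monomial adj x)
indPoly-subsetSum {N} adj x = trans (indPolyOn-subsetSum adj full x) (subsetSum-cong N inFull)
  where
  inFull : ∀ S → ind (isIndep adj S ∧ isSubsetOf S full) * (x ^ℚ ∣ S ∣) ≡ monomial adj x S
  inFull S = cong (λ b → ind b * (x ^ℚ ∣ S ∣))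
                  (trans (cong (isIndep adj S ∧_) (⊆-full S)) (∧-identityʳ (isIndep adj S)))

-- A subset T of the q copies of H, i.e. of Fin (q * m), seen as q subsets of Fin m: block i
-- is the part of T in copy i (vertex a of copy i is combine i a, as in prodVertex).
block : ∀ q {m} → Vec Bool (q ℕ.* m) → Fin q → Subset m
block q T i = V.tabulate (λ a → lookup T (combine i a))

block-zero : ∀ {q m} (A : Subset m) (B : Vec Bool (q ℕ.* m)) → block (suc q) (A V.++ B) F.zero ≡ A
block-zero A B = trans (VP.tabulate-cong (λ a → VP.lookup-++ˡ A B a)) (VP.tabulate∘lookup A)

block-suc : ∀ {q m} (A : Subset m) (B : Vec Bool (q ℕ.* m)) i → block (suc q) (A V.++ B) (F.suc i) ≡ block q B i
block-suc A B i = VP.tabulate-cong (λ a → VP.lookup-++ʳ A B (combine i a))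

∣++∣ : ∀ {a b} (A : Subset a) (B : Subset b) → ∣ A V.++ B ∣ ≡ ∣ A ∣ ℕ.+ ∣ B ∣
∣++∣ []          B = refl
∣++∣ (true ∷ A)  B = cong suc (∣++∣ A B)
∣++∣ (false ∷ A) B = ∣++∣ A B

∣∣-blocks : ∀ q {m} (T : Vec Bool (q ℕ.* m)) → ∣ T ∣ ≡ sumN q (λ i → ∣ block q T i ∣)
∣∣-blocks zero        []  = refl
∣∣-blocks (suc q) {m} T with V.splitAt m T
... | A , B , refl =
  trans (∣++∣ A B) (cong₂ ℕ._+_ (cong ∣_∣ (sym (block-zero {q} A B)))
                                (trans (∣∣-blocks q B) (sumN-cong q (λ i → cong ∣_∣ (sym (block-suc A B i))))))

blockWeight-prodF : ∀ q {m} (p : Fin q → Subset m → Bool) x (T : Vec Bool (q ℕ.* m)) →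
  ind (allF q (λ i → p i (block q T i))) * (x ^ℚ ∣ T ∣)
    ≡ prodF q (λ i → ind (p i (block q T i)) * (x ^ℚ ∣ block q T i ∣))
blockWeight-prodF q p x T = begin
    ind (allF q (λ i → p i (block q T i))) * (x ^ℚ ∣ T ∣)
  ≡⟨ cong₂ _*_ (ind-allF q _) (trans (cong (x ^ℚ_) (∣∣-blocks q T)) (^ℚ-sumN x q _)) ⟩
    prodF q (λ i → ind (p i (block q T i))) * prodF q (λ i → x ^ℚ ∣ block q T i ∣)
  ≡⟨ sym (prodF-* q _ _) ⟩
    prodF q (λ i → ind (p i (block q T i)) * (x ^ℚ ∣ block q T i ∣))
  ∎
  where open ≡-Reasoning

subsetSum-blocks : ∀ q {m} (g : Fin q → Subset m → ℚ) →
  subsetSum (q ℕ.* m) (λ T → prodF q (λ i → g i (block q T i))) ≡ prodF q (λ i → subsetSum m (g i))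
subsetSum-blocks zero    g = +-identityʳ 1ℚ
subsetSum-blocks (suc q) {m} g = begin
    subsetSum (m ℕ.+ q ℕ.* m) (λ T → prodF (suc q) (λ i → g i (block (suc q) T i)))
  ≡⟨ subsetSum-++ m (q ℕ.* m) _ ⟩
    subsetSum m (λ A → subsetSum (q ℕ.* m) (λ B → prodF (suc q) (λ i → g i (block (suc q) (A V.++ B) i))))
  ≡⟨ subsetSum-cong m (λ A → subsetSum-cong (q ℕ.* m) (λ B → firstBlock A B)) ⟩
    subsetSum m (λ A → subsetSum (q ℕ.* m) (λ B → g F.zero A * prodF q (λ i → g (F.suc i) (block q B i))))
  ≡⟨ subsetSum-cong m (λ A → subsetSum-*ˡ (q ℕ.* m) _ (g F.zero A)) ⟩
    subsetSum m (λ A → g F.zero A * subsetSum (q ℕ.* m) (λ B → prodF q (λ i → g (F.suc i) (block q B i))))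
  ≡⟨ subsetSum-cong m (λ A → cong (g F.zero A *_) (subsetSum-blocks q (λ i → g (F.suc i)))) ⟩
    subsetSum m (λ A → g F.zero A * prodF q (λ i → subsetSum m (g (F.suc i))))
  ≡⟨ subsetSum-*ʳ m (g F.zero) _ ⟩
    prodF (suc q) (λ i → subsetSum m (g i))
  ∎
  where
  open ≡-Reasoning
  firstBlock : ∀ A B → prodF (suc q) (λ i → g i (block (suc q) (A V.++ B) i))
                       ≡ g F.zero A * prodF q (λ i → g (F.suc i) (block q B i))
  firstBlock A B = cong₂ _*_ (cong (g F.zero) (block-zero {q} A B))
                             (prodF-cong q (λ i → cong (g (F.suc i)) (block-suc A B i)))

meets : ∀ {n q} → Subset n → (Fin n → Fin q) → Fin q → Bool
meets {n} S c i = anyF n (λ u → lookup S u ∧ ⌊ c u FP.≟ i ⌋)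

meets⇒ : ∀ {n q} S (c : Fin n → Fin q) i → meets S c i ≡ true → Σ (Fin n) (λ u → lookup S u ≡ true × c u ≡ i)
meets⇒ {n} S c i e with anyF⇒ n _ e
... | u , Su∧cu≡i = u , ∧-true₁ Su∧cu≡i , ≟-true⁻¹ (∧-true₂ {lookup S u} Su∧cu≡i)

⇒meets : ∀ {n q} S (c : Fin n → Fin q) i u → lookup S u ≡ true → c u ≡ i → meets S c i ≡ true
⇒meets {n} S c i u Su cu≡i = ⇒anyF n _ u (true-∧ Su (≟-true cu≡i))

-- The classes of c are cliques: distinct vertices with the same index are adjacent.  This is
-- the part of IsCliqueCover that the formula uses.
ClassesAreCliques : ∀ {n q} → Adj n → (Fin n → Fin q) → Set
ClassesAreCliques adj c = ∀ u v → u ≢ v → c u ≡ c v → adj u v ≡ true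

-- An independent set meets each clique of a clique cover in at most one vertex, so the
-- number of cliques it meets is its size.
meets-count : ∀ {n q} (adj : Adj n) (c : Fin n → Fin q) → ClassesAreCliques adj c →
              ∀ S → Independent adj S → sumN q (λ i → toN (meets S c i)) ≡ ∣ S ∣
meets-count {n} {q} adj c cliques S independent = sym (begin
    ∣ S ∣
  ≡⟨ ∣∣-as-sum S ⟩
    sumN n (λ u → toN (lookup S u))
  ≡⟨ sumN-cong n inOneClique ⟩
    sumN n (λ u → sumN q (λ i → toN (lookup S u ∧ ⌊ c u FP.≟ i ⌋)))
  ≡⟨ sumN-swap n q _ ⟩
    sumN q (λ i → sumN n (λ u → toN (lookup S u ∧ ⌊ c u FP.≟ i ⌋)))
  ≡⟨ sumN-cong q (λ i → sumN-atMostOne n _ (atMostOneVertex i)) ⟩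
    sumN q (λ i → toN (meets S c i))
  ∎)
  where
  open ≡-Reasoning
  ∣∣-as-sum : ∀ {k} (T : Subset k) → ∣ T ∣ ≡ sumN k (λ u → toN (lookup T u))
  ∣∣-as-sum []          = refl
  ∣∣-as-sum (true ∷ T)  = cong suc (∣∣-as-sum T)
  ∣∣-as-sum (false ∷ T) = ∣∣-as-sum T
  inOneClique : ∀ u → toN (lookup S u) ≡ sumN q (λ i → toN (lookup S u ∧ ⌊ c u FP.≟ i ⌋))
  inOneClique u with lookup S u
  ... | true  = sym (sumN-δ q (c u))
  ... | false = sym (sumN-zero q)
  sameClique : ∀ i u v → lookup S u ∧ ⌊ c u FP.≟ i ⌋ ≡ true → lookup S v ∧ ⌊ c v FP.≟ i ⌋ ≡ true → c u ≡ c v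
  sameClique i u v uᵢ vᵢ = trans (≟-true⁻¹ (∧-true₂ {lookup S u} uᵢ)) (sym (≟-true⁻¹ (∧-true₂ {lookup S v} vᵢ)))
  atMostOneVertex : ∀ i u v → lookup S u ∧ ⌊ c u FP.≟ i ⌋ ≡ true → lookup S v ∧ ⌊ c v FP.≟ i ⌋ ≡ true → u ≡ v
  atMostOneVertex i u v uᵢ vᵢ with u FP.≟ v
  ... | yes u≡v = u≡v
  ... | no u≢v with trans (sym (cliques u v u≢v (sameClique i u v uᵢ vᵢ)))
                          (independent u v (∧-true₁ uᵢ) (∧-true₁ vᵢ))
  ...   | ()

rescale : ∀ {n q} (adj : Adj n) (c : Fin n → Fin q) → ClassesAreCliques adj c →
  ∀ (K J r x : ℚ) → r * K ≡ J → ∀ S →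
  monomial adj x S * prodF q (λ i → if meets S c i then J else K) ≡ (K ^ℚ q) * monomial adj (x * r) S
rescale {q = q} adj c cliques K J r x r*K≡J S with isIndep adj S in indS
... | false = begin
    0ℚ * (x ^ℚ ∣ S ∣) * prodF q (λ i → if meets S c i then J else K)
  ≡⟨ cong (_* prodF q (λ i → if meets S c i then J else K)) (*-zeroˡ (x ^ℚ ∣ S ∣)) ⟩
    0ℚ * prodF q (λ i → if meets S c i then J else K)
  ≡⟨ *-zeroˡ (prodF q (λ i → if meets S c i then J else K)) ⟩
    0ℚ
  ≡⟨ sym (trans (cong (K ^ℚ q *_) (*-zeroˡ ((x * r) ^ℚ ∣ S ∣))) (*-zeroʳ (K ^ℚ q))) ⟩
    (K ^ℚ q) * (0ℚ * ((x * r) ^ℚ ∣ S ∣))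
  ∎
  where open ≡-Reasoning
... | true  = begin
    1ℚ * (x ^ℚ ∣ S ∣) * prodF q (λ i → if meets S c i then J else K)
  ≡⟨ cong₂ _*_ (*-identityˡ (x ^ℚ ∣ S ∣)) (prodF-cong q (λ i → cong (λ z → if meets S c i then z else K) (sym r*K≡J))) ⟩
    (x ^ℚ ∣ S ∣) * prodF q (λ i → if meets S c i then r * K else K)
  ≡⟨ cong ((x ^ℚ ∣ S ∣) *_) (prodF-select q K r (meets S c)) ⟩
    (x ^ℚ ∣ S ∣) * ((K ^ℚ q) * (r ^ℚ sumN q (λ i → toN (meets S c i))))
  ≡⟨ cong (λ k → (x ^ℚ ∣ S ∣) * ((K ^ℚ q) * (r ^ℚ k))) (meets-count adj c cliques S (isIndep⇒Independent adj S indS)) ⟩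
    (x ^ℚ ∣ S ∣) * ((K ^ℚ q) * (r ^ℚ ∣ S ∣))
  ≡⟨ *-leftComm (x ^ℚ ∣ S ∣) (K ^ℚ q) (r ^ℚ ∣ S ∣) ⟩
    (K ^ℚ q) * ((x ^ℚ ∣ S ∣) * (r ^ℚ ∣ S ∣))
  ≡⟨ cong (K ^ℚ q *_) (trans (sym (^ℚ-* x r ∣ S ∣)) (sym (*-identityˡ _))) ⟩
    (K ^ℚ q) * (1ℚ * ((x * r) ^ℚ ∣ S ∣))
  ∎
  where open ≡-Reasoning

-- Independent sets of the clique cover product and the summation over them.  A vertex set
-- of the product is S ++ T with S ⊆ V(G) and T ⊆ (copies of H).
module CliqueCoverProductOf {n q m : ℕ} (adjG : Adj n) (c : Fin n → Fin q) (adjH : Adj m) (U : Subset m) where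

  P : Adj (n ℕ.+ q ℕ.* m)
  P = cliqueCoverProduct adjG q c adjH U

  member : Subset n → Vec Bool (q ℕ.* m) → Fin n ⊎ (Fin q × Fin m) → Bool
  member S T (inj₁ u)       = lookup S u
  member S T (inj₂ (i , a)) = lookup (block q T i) a

  lookup-++-member : ∀ S T v → lookup (S V.++ T) v ≡ member S T (prodVertex n q m v)
  lookup-++-member S T v rewrite VP.lookup-splitAt n S T v with splitAt n v
  ... | inj₁ u = refl
  ... | inj₂ w = sym (trans (VP.lookup∘tabulate _ (proj₂ (remQuot {q} m w)))
                            (cong (lookup T) (FP.combine-remQuot {q} m w)))

  prodVertex-onto : ∀ x → Σ (Fin (n ℕ.+ q ℕ.* m)) (λ v → prodVertex n q m v ≡ x)
  prodVertex-onto (inj₁ u)       = u ↑ˡ (q ℕ.* m) , fromG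
    where
    fromG : prodVertex n q m (u ↑ˡ (q ℕ.* m)) ≡ inj₁ u
    fromG rewrite FP.splitAt-↑ˡ n u (q ℕ.* m) = refl
  prodVertex-onto (inj₂ (i , a)) = n ↑ʳ combine i a , fromCopy
    where
    fromCopy : prodVertex n q m (n ↑ʳ combine i a) ≡ inj₂ (i , a)
    fromCopy rewrite FP.splitAt-↑ʳ n (q ℕ.* m) (combine i a) | FP.remQuot-combine {q} {m} i a = refl

  IndependentPair : Subset n → Vec Bool (q ℕ.* m) → Set
  IndependentPair S T = ∀ x y → member S T x ≡ true → member S T y ≡ true → prodAdj' adjG c adjH U x y ≡ false

  -- Since prodVertex is onto, independence can be checked on structured vertices.
  Independent⇒Pair : ∀ S T → Independent P (S V.++ T) → IndependentPair S T
  Independent⇒Pair S T h x y Sx Sy with prodVertex-onto x | prodVertex-onto y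
  ... | v , refl | w , refl = h v w (trans (lookup-++-member S T v) Sx) (trans (lookup-++-member S T w) Sy)

  Pair⇒Independent : ∀ S T → IndependentPair S T → Independent P (S V.++ T)
  Pair⇒Independent S T h v w Sv Sw =
    h (prodVertex n q m v) (prodVertex n q m w) (trans (sym (lookup-++-member S T v)) Sv) (trans (sym (lookup-++-member S T w)) Sw)

  -- S ++ T is independent iff S is independent in G, every block is independent in H, and
  -- the block of a clique met by S avoids U.
  Admissible : Subset n → Vec Bool (q ℕ.* m) → Set
  Admissible S T = Independent adjG S × (∀ i → Independent adjH (block q T i)) ×
                   (∀ i → meets S c i ≡ true → ∀ a → lookup (block q T i) a ≡ true → lookup U a ≡ false)

  Pair⇒Admissible : ∀ S T → IndependentPair S T → Admissible S T
  Pair⇒Admissible S T h = (λ u v → h (inj₁ u) (inj₁ v)) , inCopy , avoidsU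
    where
    inCopy : ∀ i → Independent adjH (block q T i)
    inCopy i a b Ta Tb with h (inj₂ (i , a)) (inj₂ (i , b)) Ta Tb
    ... | ab rewrite ≟-true {q} {i} refl = ab
    avoidsU : ∀ i → meets S c i ≡ true → ∀ a → lookup (block q T i) a ≡ true → lookup U a ≡ false
    avoidsU i met a Ta with meets⇒ S c i met
    ... | u , Su , cu≡i with h (inj₁ u) (inj₂ (i , a)) Su Ta
    ...   | ua rewrite ≟-true cu≡i = ua

  Admissible⇒Pair : ∀ S T → Admissible S T → IndependentPair S T
  Admissible⇒Pair S T (indG , indH , avoidsU) (inj₁ u) (inj₁ v) Su Sv = indG u v Su Sv
  Admissible⇒Pair S T (indG , indH , avoidsU) (inj₁ u) (inj₂ (i , a)) Su Ta with c u FP.≟ i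
  ... | yes cu≡i = avoidsU i (⇒meets S c i u Su cu≡i) a Ta
  ... | no _     = refl
  Admissible⇒Pair S T (indG , indH , avoidsU) (inj₂ (i , a)) (inj₁ u) Ta Su with c u FP.≟ i
  ... | yes cu≡i = avoidsU i (⇒meets S c i u Su cu≡i) a Ta
  ... | no _     = refl
  Admissible⇒Pair S T (indG , indH , avoidsU) (inj₂ (i , a)) (inj₂ (j , b)) Ta Tb with i FP.≟ j
  ... | yes refl = indH i a b Ta Tb
  ... | no _     = refl

  admissibleBlock : Subset n → Fin q → Subset m → Bool
  admissibleBlock S i T′ = isIndep adjH T′ ∧ (not (meets S c i) ∨ isSubsetOf T′ (compl U))

  isAdmissible : Subset n → Vec Bool (q ℕ.* m) → Bool
  isAdmissible S T = isIndep adjG S ∧ allF q (λ i → admissibleBlock S i (block q T i))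

  isAdmissible⇒Admissible : ∀ S T → isAdmissible S T ≡ true → Admissible S T
  isAdmissible⇒Admissible S T e =
    isIndep⇒Independent adjG S (∧-true₁ e) , (λ i → isIndep⇒Independent adjH (block q T i) (∧-true₁ (blockOk i))) , avoidsU
    where
    blockOk : ∀ i → admissibleBlock S i (block q T i) ≡ true
    blockOk = allF⇒ q _ (∧-true₂ {isIndep adjG S} e)
    avoidsU : ∀ i → meets S c i ≡ true → ∀ a → lookup (block q T i) a ≡ true → lookup U a ≡ false
    avoidsU i met a Ta with ∧-true₂ {isIndep adjH (block q T i)} (blockOk i)
    ... | inComplU rewrite met =
      not-true (trans (sym (lookup-compl U a)) (isSubsetOf⇒⊆ (block q T i) (compl U) inComplU a Ta))

  Admissible⇒isAdmissible : ∀ S T → Admissible S T → isAdmissible S T ≡ true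
  Admissible⇒isAdmissible S T (indG , indH , avoidsU) =
    true-∧ (Independent⇒isIndep adjG S indG)
           (⇒allF q _ (λ i → true-∧ (Independent⇒isIndep adjH (block q T i) (indH i)) (avoidsIfMet i)))
    where
    avoidsIfMet : ∀ i → not (meets S c i) ∨ isSubsetOf (block q T i) (compl U) ≡ true
    avoidsIfMet i with meets S c i in met
    ... | false = refl
    ... | true  = ⊆⇒isSubsetOf (block q T i) (compl U)
                    (λ a Ta → trans (lookup-compl U a) (cong not (avoidsU i met a Ta)))

  isIndep-product : ∀ S T → isIndep P (S V.++ T) ≡ isAdmissible S T
  isIndep-product S T = bool-ext
    (λ e → Admissible⇒isAdmissible S T (Pair⇒Admissible S T (Independent⇒Pair S T (isIndep⇒Independent P (S V.++ T) e))))
    (λ e → Independent⇒isIndep P (S V.++ T) (Pair⇒Independent S T (Admissible⇒Pair S T (isAdmissible⇒Admissible S T e))))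

  monomial-product : ∀ x S T →
    monomial P x (S V.++ T)
      ≡ monomial adjG x S * prodF q (λ i → ind (admissibleBlock S i (block q T i)) * (x ^ℚ ∣ block q T i ∣))
  monomial-product x S T = begin
      ind (isIndep P (S V.++ T)) * (x ^ℚ ∣ S V.++ T ∣)
    ≡⟨ cong₂ _*_ (cong ind (isIndep-product S T)) (trans (cong (x ^ℚ_) (∣++∣ S T)) (^ℚ-+ x ∣ S ∣ ∣ T ∣)) ⟩
      ind (isIndep adjG S ∧ blocksOk) * ((x ^ℚ ∣ S ∣) * (x ^ℚ ∣ T ∣))
    ≡⟨ cong (_* ((x ^ℚ ∣ S ∣) * (x ^ℚ ∣ T ∣))) (ind-∧ (isIndep adjG S) blocksOk) ⟩
      (ind (isIndep adjG S) * ind blocksOk) * ((x ^ℚ ∣ S ∣) * (x ^ℚ ∣ T ∣))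
    ≡⟨ *-interchange (ind (isIndep adjG S)) (ind blocksOk) (x ^ℚ ∣ S ∣) (x ^ℚ ∣ T ∣) ⟩
      monomial adjG x S * (ind blocksOk * (x ^ℚ ∣ T ∣))
    ≡⟨ cong (monomial adjG x S *_) (blockWeight-prodF q (admissibleBlock S) x T) ⟩
      monomial adjG x S * prodF q (λ i → ind (admissibleBlock S i (block q T i)) * (x ^ℚ ∣ block q T i ∣))
    ∎
    where
    open ≡-Reasoning
    blocksOk : Bool
    blocksOk = allF q (λ i → admissibleBlock S i (block q T i))

  blockSum : ∀ x (met : Bool) →
    subsetSum m (λ T′ → ind (isIndep adjH T′ ∧ (not met ∨ isSubsetOf T′ (compl U))) * (x ^ℚ ∣ T′ ∣))
      ≡ (if met then indPolyMinus adjH U x else indPoly adjH x)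
  blockSum x true  = sym (indPolyOn-subsetSum adjH (compl U) x)
  blockSum x false =
    trans (subsetSum-cong m (λ T′ → cong (λ b → ind b * (x ^ℚ ∣ T′ ∣)) (∧-identityʳ (isIndep adjH T′))))
          (sym (indPoly-subsetSum adjH x))

  sumOverCopies : ∀ x S →
    subsetSum (q ℕ.* m) (λ T → monomial P x (S V.++ T))
      ≡ monomial adjG x S * prodF q (λ i → if meets S c i then indPolyMinus adjH U x else indPoly adjH x)
  sumOverCopies x S = begin
      subsetSum (q ℕ.* m) (λ T → monomial P x (S V.++ T))
    ≡⟨ subsetSum-cong (q ℕ.* m) (monomial-product x S) ⟩
      subsetSum (q ℕ.* m) (λ T → monomial adjG x S * prodF q (λ i → weight i (block q T i)))
    ≡⟨ subsetSum-*ˡ (q ℕ.* m) _ (monomial adjG x S) ⟩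
      monomial adjG x S * subsetSum (q ℕ.* m) (λ T → prodF q (λ i → weight i (block q T i)))
    ≡⟨ cong (monomial adjG x S *_) (subsetSum-blocks q weight) ⟩
      monomial adjG x S * prodF q (λ i → subsetSum m (weight i))
    ≡⟨ cong (monomial adjG x S *_) (prodF-cong q (λ i → blockSum x (meets S c i))) ⟩
      monomial adjG x S * prodF q (λ i → if meets S c i then indPolyMinus adjH U x else indPoly adjH x)
    ∎
    where
    open ≡-Reasoning
    weight : Fin q → Subset m → ℚ
    weight i T′ = ind (admissibleBlock S i T′) * (x ^ℚ ∣ T′ ∣)

theorem1p1 : ∀ {n m : ℕ} (adjG : Adj n) (adjH : Adj m) → IsSimple adjG → IsSimple adjH →
    (q : ℕ) (c : Fin n → Fin q) → IsCliqueCover adjG q c → (U : Subset m) →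
    (x : ℚ) → .{{_ : NonZero (indPoly adjH x)}} →
    indPoly (cliqueCoverProduct adjG q c adjH U) x
      ≡ ((indPoly adjH x) ^ℚ q) * indPoly adjG ((x * indPolyMinus adjH U x) ÷ indPoly adjH x)
theorem1p1 {n} {m} adjG adjH _ _ q c (_ , cliques) U x = begin
    indPoly P x
  ≡⟨ trans (indPoly-subsetSum P x) (subsetSum-++ n (q ℕ.* m) (monomial P x)) ⟩
    subsetSum n (λ S → subsetSum (q ℕ.* m) (λ T → monomial P x (S V.++ T)))
  ≡⟨ subsetSum-cong n (sumOverCopies x) ⟩
    subsetSum n (λ S → monomial adjG x S * prodF q (λ i → if meets S c i then IH-U else IH))
  ≡⟨ subsetSum-cong n (rescale adjG c cliques IH IH-U ratio x ratio*IH≡IH-U) ⟩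
    subsetSum n (λ S → (IH ^ℚ q) * monomial adjG (x * ratio) S)
  ≡⟨ subsetSum-*ˡ n (monomial adjG (x * ratio)) (IH ^ℚ q) ⟩
    (IH ^ℚ q) * subsetSum n (monomial adjG (x * ratio))
  ≡⟨ cong (IH ^ℚ q *_) (sym (indPoly-subsetSum adjG (x * ratio))) ⟩
    (IH ^ℚ q) * indPoly adjG (x * ratio)
  ≡⟨ cong (λ y → (IH ^ℚ q) * indPoly adjG y) (sym (*-assoc x IH-U (1/ IH))) ⟩
    (IH ^ℚ q) * indPoly adjG ((x * IH-U) ÷ IH)
  ∎
  where
  open ≡-Reasoning
  open CliqueCoverProductOf adjG c adjH U
  IH IH-U ratio : ℚ
  IH = indPoly adjH x
  IH-U = indPolyMinus adjH U x
  ratio = IH-U ÷ IH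
  ratio*IH≡IH-U : ratio * IH ≡ IH-U
  ratio*IH≡IH-U = trans (*-assoc IH-U (1/ IH) IH) (trans (cong (IH-U *_) (*-inverseˡ IH)) (*-identityʳ IH-U))
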